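{- If $G$ is a graph of minimum degree at least 2, then $M'(\overleftrightarrow{G}) \leq 3$.
   Context: Graphs are finite, simple and undirected. The symmetric digraph $\overleftrightarrow{G}$ is obtained from $G$ by replacing each edge $uv$ by the pair of opposite arcs $\overrightarrow{uv}$ and $\overrightarrow{vu}$. An arc coloring $c : A(D) \to [k]$ of a digraph $D$ is a majority arc coloring if for every vertex $u$ and every color $\alpha \in [k]$, at most half of the arcs entering $u$ have color $\alpha$ and at most half of the arcs leaving $u$ have color $\alpha$. $M'(D)$ is the least $k$ such that $D$ has a majority arc coloring with $k$ colors. -}

module Defs where

open import Data.Nat using (ℕ; _*_; _≤_)
open import Data.Bool using (Bool; true; false; T; _∧_)
open import Data.Fin using (Fin)
open import Data.Fin.Properties using () renaming (_≟_ to _≟ᶠ_)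
open import Data.List using (List; length; filterᵇ)
open import Data.List.Base using (allFin)
open import Relation.Nullary.Decidable using (⌊_⌋)
open import Relation.Binary.PropositionalEquality using (_≡_)
open import Data.Product using (Σ; _×_)

record Graph : Set where
  field
    n     : ℕ
    adj   : Fin n → Fin n → Bool
    sym   : ∀ u v → adj u v ≡ adj v u
    irrefl : ∀ u → adj u u ≡ false

open Graph public

deg : (G : Graph) → Fin (n G) → ℕ
deg G u = length (filterᵇ (λ v → adj G u v) (allFin (n G)))

minDegree≥ : Graph → ℕ → Set
minDegree≥ G d = ∀ u → d ≤ deg G u

-- The symmetric digraph of G has arc set { (u,v) | uv ∈ E(G) }.
-- An arc colouring with k colours: a colour for every ordered pair;
-- only the values on arcs (adj u v = true) are relevant.
ArcColouring : Graph → ℕ → Set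
ArcColouring G k = Fin (n G) → Fin (n G) → Fin k

outColourCount : (G : Graph) {k : ℕ} → ArcColouring G k → Fin (n G) → Fin k → ℕ
outColourCount G c u α =
  length (filterᵇ (λ v → adj G u v ∧ ⌊ c u v ≟ᶠ α ⌋) (allFin (n G)))

inColourCount : (G : Graph) {k : ℕ} → ArcColouring G k → Fin (n G) → Fin k → ℕ
inColourCount G c u α =
  length (filterᵇ (λ v → adj G v u ∧ ⌊ c v u ≟ᶠ α ⌋) (allFin (n G)))

-- In the symmetric digraph, in-degree = out-degree = deg G u.
IsMajorityArcColouring : (G : Graph) {k : ℕ} → ArcColouring G k → Set
IsMajorityArcColouring G {k} c =
  ∀ (u : Fin (n G)) (α : Fin k) →
    (2 * outColourCount G c u α ≤ deg G u) × (2 * inColourCount G c u α ≤ deg G u)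

-- M'(↔G) ≤ m  :⇔  some k ≤ m admits a majority arc colouring of ↔G with k colours
-- (M' is the least such k).
M'≤ : Graph → ℕ → Set
M'≤ G m = Σ ℕ (λ k → (k ≤ m) × Σ (ArcColouring G k) (IsMajorityArcColouring G))

{-# OPTIONS --safe #-}
-- Number the neighbours of each vertex u by 0, …, deg u − 1 and cut them into ⌈deg u / 3⌉ groups
-- of at most three. The arcs u → v then form a bipartite multigraph between the out-groups
-- (u, group of v at u) and the in-groups (v, group of u at v) of maximum degree 3, which by
-- König's edge-colouring theorem (Kempe exchanges along alternating paths) has a proper
-- 3-edge-colouring. Each colour then occurs at most once per group, so at most ⌈d/3⌉ times
-- among the d arcs leaving or entering a vertex of degree d, and 2⌈d/3⌉ ≤ d once d ≥ 2.
module Submission where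

open import Defs hiding (sym)

open import Data.Bool using (Bool; T; _∧_)
open import Data.Bool.Properties using (T?; T-∧; T-irrelevant)
open import Data.Empty using (⊥; ⊥-elim)
open import Data.Fin as Fin using (Fin; toℕ; inject≤; remQuot; combine)
import Data.Fin.Properties as Fin
open import Data.List using (List; length; lookup; allFin; filterᵇ)
open import Data.List.Membership.Propositional using (_∈_)
open import Data.List.Membership.Propositional.Properties
  using (∈-lookup; ∈-allFin; ∈-filter⁺; ∈-filter⁻)
open import Data.List.Relation.Unary.All as All using ()
open import Data.List.Relation.Unary.AllPairs using (_∷_)
open import Data.List.Relation.Unary.Any as Any using ()
open import Data.List.Relation.Unary.Any.Properties using (lookup-index)
open import Data.List.Relation.Unary.Unique.Propositional using (Unique)
import Data.List.Relation.Unary.Unique.Propositional.Properties as Unique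
open import Data.Maybe using (Maybe; just; nothing; _>>=_)
import Data.Maybe.Properties as Maybe
open import Data.Nat as ℕ using (ℕ; zero; suc; _+_; _*_; _/_; _%_; _≤_; _<_; z≤n; s≤s)
import Data.Nat.Properties as ℕ
open import Data.Nat.DivMod using (m≡m%n+[m/n]*n; m%n<n; m/n*n≤m)
open import Data.Product as Product using (Σ; ∃; _×_; _,_; proj₁; proj₂; uncurry; swap)
import Data.Product.Properties as Product
open import Data.Sum using (_⊎_; inj₁; inj₂)
import Data.Sum.Properties as Sum
open import Data.Vec.Functional using (updateAt)
open import Data.Vec.Functional.Properties using (updateAt-updates; updateAt-minimal)
open import Function using (_∘_; _$_; const; Injective; Equivalence)
open import Relation.Binary using (DecidableEquality)
open import Relation.Binary.PropositionalEquality
open import Relation.Nullary using (Dec; yes; no; ¬_; contradiction)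
open import Relation.Nullary.Decidable using (_×-dec_; ⌊_⌋; map′; toWitness; dec-yes-irr)

lookup-injective : ∀ {A : Set} {xs : List A} → Unique xs → Injective _≡_ _≡_ (lookup xs)
lookup-injective (_ ∷ _)     {Fin.zero}  {Fin.zero}  _  = refl
lookup-injective (x∉xs ∷ _)  {Fin.zero}  {Fin.suc j} eq =
  contradiction eq (All.lookup x∉xs (∈-lookup j))
lookup-injective (x∉xs ∷ _)  {Fin.suc i} {Fin.zero}  eq =
  contradiction (sym eq) (All.lookup x∉xs (∈-lookup i))
lookup-injective (_ ∷ uniq) {Fin.suc i} {Fin.suc j} eq = cong Fin.suc (lookup-injective uniq eq)

length-≤-by-injection : ∀ {A : Set} {xs : List A} {K : ℕ} → Unique xs →
  (f : ∀ {x} → x ∈ xs → Fin K) → (∀ {x y} (p : x ∈ xs) (q : y ∈ xs) → f p ≡ f q → x ≡ y) →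
  length xs ≤ K
length-≤-by-injection u f f-inj =
  Fin.injective⇒≤ λ {i} {j} eq → lookup-injective u (f-inj (∈-lookup i) (∈-lookup j) eq)

remQuot-injective : ∀ {m} n → Injective _≡_ _≡_ (remQuot {m} n)
remQuot-injective {m} n {i} {j} eq = begin
  i                                  ≡⟨ sym (Fin.combine-remQuot {m} n i) ⟩
  uncurry combine (remQuot {m} n i)  ≡⟨ cong (uncurry combine) eq ⟩
  uncurry combine (remQuot {m} n j)  ≡⟨ Fin.combine-remQuot {m} n j ⟩
  j                                  ∎
  where open ≡-Reasoning

⌈_/3⌉ : ℕ → ℕ
⌈ d /3⌉ = (d + 2) / 3

d≤⌈d/3⌉*3 : ∀ d → d ≤ ⌈ d /3⌉ * 3
d≤⌈d/3⌉*3 d = ℕ.+-cancelʳ-≤ 2 d (⌈ d /3⌉ * 3) (begin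
  d + 2                          ≡⟨ m≡m%n+[m/n]*n (d + 2) 3 ⟩
  (d + 2) % 3 + ⌈ d /3⌉ * 3      ≤⟨ ℕ.+-monoˡ-≤ _ (ℕ.≤-pred (m%n<n (d + 2) 3)) ⟩
  2 + ⌈ d /3⌉ * 3                ≡⟨ ℕ.+-comm 2 _ ⟩
  ⌈ d /3⌉ * 3 + 2                ∎)
  where open ℕ.≤-Reasoning

2*⌈d/3⌉≤d : ∀ {d} → 2 ≤ d → 2 * ⌈ d /3⌉ ≤ d
2*⌈d/3⌉≤d {d} 2≤d with ⌈ d /3⌉ ℕ.≤? 1
... | yes q≤1 = ℕ.≤-trans (ℕ.*-monoʳ-≤ 2 q≤1) 2≤d
... | no q≰1 = ℕ.+-cancelʳ-≤ 2 (2 * q) d (begin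
  2 * q + 2        ≤⟨ ℕ.+-monoʳ-≤ (2 * q) (ℕ.≰⇒> q≰1) ⟩
  2 * q + q        ≡⟨ trans (ℕ.+-comm (2 * q) q) (ℕ.*-comm 3 q) ⟩
  q * 3            ≤⟨ m/n*n≤m (d + 2) 3 ⟩
  d + 2            ∎)
  where q = ⌈ d /3⌉
        open ℕ.≤-Reasoning

-- A bipartite multigraph with edge set Fin m; numbering the edges at every vertex injectively
-- by slots in Fin Δ bounds its maximum degree by Δ.
module BipartiteEdgeColouring
  {m Δ : ℕ} {X Y : Set} (_≟X_ : DecidableEquality X) (_≟Y_ : DecidableEquality Y)
  (L : Fin m → X) (R : Fin m → Y) (slotL slotR : Fin m → Fin Δ)
  (slotL-injective : ∀ e f → L e ≡ L f → slotL e ≡ slotL f → e ≡ f)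
  (slotR-injective : ∀ e f → R e ≡ R f → slotR e ≡ slotR f → e ≡ f)
  where

  Colouring : Set
  Colouring = Fin m → Fin Δ

  -- Only the first k edges count as coloured.
  ProperAt : {Z : Set} → (Fin m → Z) → ℕ → Colouring → Set
  ProperAt end k c = ∀ e f → toℕ e < k → toℕ f < k → end e ≡ end f → c e ≡ c f → e ≡ f

  Proper : ℕ → Colouring → Set
  Proper k c = ProperAt L k c × ProperAt R k c

  EdgeAt : {Z : Set} → (Fin m → Z) → ℕ → Colouring → Z → Fin Δ → Fin m → Set
  EdgeAt end k c z α e = toℕ e < k × end e ≡ z × c e ≡ α

  edgeAt? : ∀ {Z : Set} → DecidableEquality Z →
            ∀ end k c (z : Z) α → Dec (∃ (EdgeAt end k c z α))
  edgeAt? _≟Z_ end k c z α = Fin.any? λ e → toℕ e ℕ.<? k ×-dec end e ≟Z z ×-dec c e Fin.≟ α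

  Free : {Z : Set} → (Fin m → Z) → ℕ → Colouring → Z → Fin Δ → Set
  Free end k c z α = ¬ ∃ (EdgeAt end k c z α)

  -- Some colour is free at an end of an uncoloured edge e₀: otherwise the Δ edges witnessing
  -- the Δ colours, together with e₀, would need Δ + 1 distinct slots.
  free-colour : ∀ {Z : Set} → DecidableEquality Z → (end : Fin m → Z) (slot : Fin m → Fin Δ) →
    (∀ e f → end e ≡ end f → slot e ≡ slot f → e ≡ f) →
    ∀ k c e₀ → k ≤ toℕ e₀ → ∃ (Free end k c (end e₀))
  free-colour {Z} _≟Z_ end slot slot-injective k c e₀ k≤e₀ =
    decide (Fin.all? (edgeAt? _≟Z_ end k c (end e₀)))
    where
    all-used-impossible : (∀ α → ∃ (EdgeAt end k c (end e₀) α)) → ⊥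
    all-used-impossible allUsed = Fin.<⇒notInjective ℕ.≤-refl slots-injective
      where
      witness : Fin Δ → Fin m
      witness α = proj₁ (allUsed α)
      slots : Fin (suc Δ) → Fin Δ
      slots Fin.zero    = slot e₀
      slots (Fin.suc α) = slot (witness α)
      witness-≢-e₀ : ∀ α → slot e₀ ≢ slot (witness α)
      witness-≢-e₀ α eq with allUsed α
      ... | e , e<k , ee , _ with refl ← slot-injective e₀ e (sym ee) eq = ℕ.<⇒≱ e<k k≤e₀
      slots-injective : Injective _≡_ _≡_ slots
      slots-injective {Fin.zero}  {Fin.zero}  _  = refl
      slots-injective {Fin.zero}  {Fin.suc β} eq = contradiction eq (witness-≢-e₀ β)
      slots-injective {Fin.suc α} {Fin.zero}  eq = contradiction (sym eq) (witness-≢-e₀ α)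
      slots-injective {Fin.suc α} {Fin.suc β} eq with allUsed α | allUsed β
      ... | e , _ , eα , refl | f , _ , eβ , refl =
        cong (Fin.suc ∘ c) (slot-injective e f (trans eα (sym eβ)) eq)

    decide : Dec (∀ α → ∃ (EdgeAt end k c (end e₀) α)) → ∃ (Free end k c (end e₀))
    decide (yes allUsed) = ⊥-elim (all-used-impossible allUsed)
    decide (no ¬allUsed) = Fin.¬∀⟶∃¬ Δ _ (edgeAt? _≟Z_ end k c (end e₀)) ¬allUsed

  properAt-extend : ∀ {Z : Set} (end : Fin m → Z) {k c α} e₀ → toℕ e₀ ≡ k →
    Free end k c (end e₀) α → ProperAt end k c → ProperAt end (suc k) (updateAt c e₀ (const α))
  properAt-extend end {k} {c} {α} e₀ e₀≡k free proper e f e<1+k f<1+k ee ce =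
    cases (e Fin.≟ e₀) (f Fin.≟ e₀)
    where
    c′ = updateAt c e₀ (const α)

    unchanged : ∀ g → g ≢ e₀ → c′ g ≡ c g
    unchanged g g≢e₀ = updateAt-minimal g e₀ c g≢e₀

    below : ∀ {g} → toℕ g < suc k → g ≢ e₀ → toℕ g < k
    below g<1+k g≢e₀ =
      ℕ.≤∧≢⇒< (ℕ.≤-pred g<1+k) (λ g≡k → g≢e₀ (Fin.toℕ-injective (trans g≡k (sym e₀≡k))))

    cases : Dec (e ≡ e₀) → Dec (f ≡ e₀) → e ≡ f
    cases (yes refl) (yes refl) = refl
    cases (yes refl) (no f≢e₀)  = ⊥-elim $
      free (f , below f<1+k f≢e₀ , sym ee ,
            trans (sym (unchanged f f≢e₀)) (trans (sym ce) (updateAt-updates e₀ c)))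
    cases (no e≢e₀)  (yes refl) = ⊥-elim $
      free (e , below e<1+k e≢e₀ , ee ,
            trans (sym (unchanged e e≢e₀)) (trans ce (updateAt-updates e₀ c)))
    cases (no e≢e₀)  (no f≢e₀)  =
      proper e f (below e<1+k e≢e₀) (below f<1+k f≢e₀) ee
             (trans (sym (unchanged e e≢e₀)) (trans ce (unchanged f f≢e₀)))

  module EdgeLookup {Z : Set} (_≟Z_ : DecidableEquality Z) (end : Fin m → Z)
                    {k : ℕ} {c : Colouring} (proper : ProperAt end k c) where

    EdgeAt-unique : ∀ {z α e f} → EdgeAt end k c z α e → EdgeAt end k c z α f → e ≡ f
    EdgeAt-unique (e<k , ez , eα) (f<k , fz , fα) =
      proper _ _ e<k f<k (trans ez (sym fz)) (trans eα (sym fα))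

    edgeAt : Z → Fin Δ → Maybe (Fin m)
    edgeAt z α with edgeAt? _≟Z_ end k c z α
    ... | yes (e , _) = just e
    ... | no _        = nothing

    edgeAt-sound : ∀ {z α e} → edgeAt z α ≡ just e → EdgeAt end k c z α e
    edgeAt-sound {z} {α} eq with edgeAt? _≟Z_ end k c z α
    edgeAt-sound refl | yes (_ , at) = at

    edgeAt-complete : ∀ {z α e} → EdgeAt end k c z α e → edgeAt z α ≡ just e
    edgeAt-complete {z} {α} {e} at with edgeAt? _≟Z_ end k c z α
    ... | yes (_ , at′) = cong just (EdgeAt-unique at′ at)
    ... | no none       = contradiction (e , at) none

  -- Kempe's exchange: starting from the a-edge at the right vertex y, where b is free, follow
  -- the path alternating a-edges and b-edges, and swap a and b along it.
  module KempeExchange {k : ℕ} {c : Colouring} (proper : Proper k c)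
                       {a b : Fin Δ} (a≢b : a ≢ b) (y : Y) (b-free : Free R k c y b) where

    module AtL = EdgeLookup _≟X_ L (proj₁ proper)
    module AtR = EdgeLookup _≟Y_ R (proj₂ proper)

    next : Fin m → Maybe (Fin m)
    next e with c e Fin.≟ a
    ... | yes _ = AtL.edgeAt (L e) b
    ... | no _  = AtR.edgeAt (R e) a

    next-a : ∀ {e} → c e ≡ a → next e ≡ AtL.edgeAt (L e) b
    next-a {e} ca with c e Fin.≟ a
    ... | yes _   = refl
    ... | no c≢a  = contradiction ca c≢a

    next-b : ∀ {e} → c e ≡ b → next e ≡ AtR.edgeAt (R e) a
    next-b {e} cb with c e Fin.≟ a
    ... | yes ca  = contradiction (trans (sym ca) cb) a≢b
    ... | no _    = refl

    walk : ℕ → Maybe (Fin m)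
    walk zero    = AtR.edgeAt y a
    walk (suc i) = walk i >>= next

    data Step (e′ e : Fin m) : Set where
      viaL : c e′ ≡ a → c e ≡ b → L e′ ≡ L e → Step e′ e
      viaR : c e′ ≡ b → c e ≡ a → R e′ ≡ R e → Step e′ e

    walk-valid : ∀ i {e} → walk i ≡ just e → toℕ e < k × (c e ≡ a ⊎ c e ≡ b)
    walk-step  : ∀ i {e} → walk (suc i) ≡ just e →
                 ∃ λ e′ → walk i ≡ just e′ × Step e′ e × toℕ e < k

    walk-valid zero eq with AtR.edgeAt-sound eq
    ... | e<k , _ , ca = e<k , inj₁ ca
    walk-valid (suc i) eq with walk-step i eq
    ... | _ , _ , viaL _ cb _ , e<k = e<k , inj₂ cb
    ... | _ , _ , viaR _ ca _ , e<k = e<k , inj₁ ca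

    walk-step i eq with walk i in wi
    ... | just e′ with walk-valid i wi
    ...   | _ , inj₁ ca with AtL.edgeAt-sound (trans (sym (next-a ca)) eq)
    ...     | e<k , le , cb = e′ , refl , viaL ca cb (sym le) , e<k
    walk-step i eq | just e′ | _ , inj₂ cb with AtR.edgeAt-sound (trans (sym (next-b cb)) eq)
    ...     | e<k , re , ca = e′ , refl , viaR cb ca (sym re) , e<k

    walk-suc : ∀ {i e} → walk i ≡ just e → walk (suc i) ≡ next e
    walk-suc = cong (_>>= next)

    step-unique : ∀ {e₁ e₂ e} → Step e₁ e → Step e₂ e → toℕ e₁ < k → toℕ e₂ < k → e₁ ≡ e₂
    step-unique (viaL ca₁ _ l₁) (viaL ca₂ _ l₂) e₁<k e₂<k =
      proj₁ proper _ _ e₁<k e₂<k (trans l₁ (sym l₂)) (trans ca₁ (sym ca₂))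
    step-unique (viaR cb₁ _ r₁) (viaR cb₂ _ r₂) e₁<k e₂<k =
      proj₂ proper _ _ e₁<k e₂<k (trans r₁ (sym r₂)) (trans cb₁ (sym cb₂))
    step-unique (viaL _ cb _) (viaR _ ca _) _ _ = contradiction (trans (sym ca) cb) a≢b
    step-unique (viaR _ ca _) (viaL _ cb _) _ _ = contradiction (trans (sym ca) cb) a≢b

    no-step-into-start : ∀ {e e′} → walk 0 ≡ just e → Step e′ e → toℕ e′ < k → ⊥
    no-step-into-start w₀ st e′<k with AtR.edgeAt-sound w₀ | st
    ... | _ , _  , ca | viaL _ cb _  = a≢b (trans (sym ca) cb)
    ... | _ , ry , _  | viaR cb _ re = b-free (_ , e′<k , trans re ry , cb)

    walk-injective : ∀ {i j e} → i < j → walk i ≡ just e → walk j ≡ just e → ⊥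
    walk-injective {zero} {suc j} _ wi wj with walk-step j wj
    ... | _ , w′ , st , _ = no-step-into-start wi st (proj₁ (walk-valid j w′))
    walk-injective {suc i} {suc j} (s≤s i<j) wi wj with walk-step i wi | walk-step j wj
    ... | e₁ , w₁ , st₁ , _ | e₂ , w₂ , st₂ , _
      with refl ← step-unique st₁ st₂ (proj₁ (walk-valid i w₁)) (proj₁ (walk-valid j w₂)) =
      walk-injective i<j w₁ w₂

    walk-prefix : ∀ {i j e} → i ≤ j → walk j ≡ just e → ∃ λ e′ → walk i ≡ just e′
    walk-prefix {j = zero} z≤n wj = _ , wj
    walk-prefix {j = suc j} i≤1+j wj with ℕ.m≤n⇒m<n∨m≡n i≤1+j
    ... | inj₂ refl      = _ , wj
    ... | inj₁ (s≤s i≤j) = walk-prefix i≤j (proj₁ (proj₂ (walk-step j wj)))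

    walk-length : ∀ {i e} → walk i ≡ just e → i < m
    walk-length {i} wi with i ℕ.<? m
    ... | yes i<m = i<m
    ... | no i≮m = repeats (Fin.pigeonhole (ℕ.n<1+n m) (proj₁ ∘ visit))
      where
      visit : (j : Fin (suc m)) → ∃ λ e′ → walk (toℕ j) ≡ just e′
      visit j = walk-prefix (ℕ.≤-trans (Fin.toℕ≤pred[n] j) (ℕ.≮⇒≥ i≮m)) wi
      repeats : (∃ λ j → ∃ λ j′ → j Fin.< j′ × proj₁ (visit j) ≡ proj₁ (visit j′)) → i < m
      repeats (j , j′ , j<j′ , same) =
        ⊥-elim $ walk-injective j<j′ (proj₂ (visit j))
                   (subst (λ e → walk (toℕ j′) ≡ just e) (sym same) (proj₂ (visit j′)))

    OnWalk : Fin m → Set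
    OnWalk e = ∃ λ i → walk i ≡ just e

    onWalk? : ∀ e → Dec (OnWalk e)
    onWalk? e = map′ (λ (i , wi) → toℕ i , wi) bounded
                     (Fin.any? λ i → Maybe.≡-dec Fin._≟_ (walk (toℕ i)) (just e))
      where
      bounded : OnWalk e → ∃ λ (i : Fin m) → walk (toℕ i) ≡ just e
      bounded (i , wi) =
        Fin.fromℕ< i<m , subst (λ j → walk j ≡ just e) (sym (Fin.toℕ-fromℕ< i<m)) wi
        where i<m = walk-length {i} wi

    Alternate : Fin Δ → Fin Δ → Set
    Alternate γ δ = (γ ≡ a × δ ≡ b) ⊎ (γ ≡ b × δ ≡ a)

    other : Fin Δ → Fin Δ
    other γ with γ Fin.≟ a
    ... | yes _ = b
    ... | no _  = a

    alternate-other : ∀ {γ} → γ ≡ a ⊎ γ ≡ b → Alternate γ (other γ)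
    alternate-other {γ} γ∈ab with γ Fin.≟ a | γ∈ab
    ... | yes γ≡a | inj₁ _   = inj₁ (γ≡a , refl)
    ... | yes γ≡a | inj₂ γ≡b = contradiction (trans (sym γ≡a) γ≡b) a≢b
    ... | no γ≢a  | inj₁ γ≡a = contradiction γ≡a γ≢a
    ... | no _    | inj₂ γ≡b = inj₂ (γ≡b , refl)

    alternate-cancel : ∀ {γ δ γ′ δ′} → Alternate γ δ → Alternate γ′ δ′ → δ ≡ δ′ → γ ≡ γ′
    alternate-cancel (inj₁ (γa , _))  (inj₁ (γ′a , _)) _ = trans γa (sym γ′a)
    alternate-cancel (inj₂ (γb , _))  (inj₂ (γ′b , _)) _ = trans γb (sym γ′b)
    alternate-cancel (inj₁ (_ , δb))  (inj₂ (_ , δ′a)) δ≡δ′ =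
      contradiction (trans (sym δ′a) (trans (sym δ≡δ′) δb)) a≢b
    alternate-cancel (inj₂ (_ , δa))  (inj₁ (_ , δ′b)) δ≡δ′ =
      contradiction (trans (sym δa) (trans δ≡δ′ δ′b)) a≢b

    recoloured : Colouring
    recoloured e with onWalk? e
    ... | yes _ = other (c e)
    ... | no _  = c e

    recoloured-cases : ∀ e → (OnWalk e × Alternate (c e) (recoloured e))
                           ⊎ (¬ OnWalk e × recoloured e ≡ c e)
    recoloured-cases e with onWalk? e
    ... | yes (i , wi) = inj₁ ((i , wi) , alternate-other (proj₂ (walk-valid i wi)))
    ... | no off       = inj₂ (off , refl)

    closedL : ∀ {e f} → OnWalk e → toℕ f < k → L e ≡ L f → Alternate (c e) (c f) → OnWalk f
    closedL (i , we) f<k le (inj₁ (ca , cb)) =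
      suc i , trans (walk-suc {i} we)
                    (trans (next-a ca) (AtL.edgeAt-complete (f<k , sym le , cb)))
    closedL (zero , we) _ _ (inj₂ (cb , _)) with AtR.edgeAt-sound we
    ... | _ , _ , ca = contradiction (trans (sym ca) cb) a≢b
    closedL (suc i , we) f<k le (inj₂ (cb , ca)) with walk-step i we
    ... | e′ , we′ , viaL ca′ _ le′ , _ =
      i , subst (λ g → walk i ≡ just g)
                (AtL.EdgeAt-unique (proj₁ (walk-valid i we′) , trans le′ le , ca′) (f<k , refl , ca))
                we′
    ... | _ , _ , viaR _ ca′ _ , _ = contradiction (trans (sym ca′) cb) a≢b

    closedR : ∀ {e f} → OnWalk e → toℕ f < k → R e ≡ R f → Alternate (c e) (c f) → OnWalk f
    closedR (i , we) f<k re (inj₂ (cb , ca)) =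
      suc i , trans (walk-suc {i} we)
                    (trans (next-b cb) (AtR.edgeAt-complete (f<k , sym re , ca)))
    closedR (zero , we) f<k re (inj₁ (_ , cb)) with AtR.edgeAt-sound we
    ... | _ , ry , _ = ⊥-elim (b-free (_ , f<k , trans (sym re) ry , cb))
    closedR (suc i , we) f<k re (inj₁ (ca , cb)) with walk-step i we
    ... | e′ , we′ , viaR cb′ _ re′ , _ =
      i , subst (λ g → walk i ≡ just g)
                (AtR.EdgeAt-unique (proj₁ (walk-valid i we′) , trans re′ re , cb′) (f<k , refl , cb))
                we′
    ... | _ , _ , viaL _ cb′ _ , _ = contradiction (trans (sym ca) cb′) a≢b

    recoloured-properAt : ∀ {Z : Set} (end : Fin m → Z) → ProperAt end k c →
      (∀ {e f} → OnWalk e → toℕ f < k → end e ≡ end f → Alternate (c e) (c f) → OnWalk f) →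
      ProperAt end k recoloured
    recoloured-properAt end proper closed e f e<k f<k ee same
      with recoloured-cases e | recoloured-cases f
    ... | inj₁ (_ , alt)   | inj₁ (_ , alt′)  = proper e f e<k f<k ee (alternate-cancel alt alt′ same)
    ... | inj₂ (_ , re)    | inj₂ (_ , rf)    = proper e f e<k f<k ee (trans (sym re) (trans same rf))
    ... | inj₁ (on , alt)  | inj₂ (off , rf)  =
      ⊥-elim (off (closed on f<k ee (subst (Alternate (c e)) (trans same rf) alt)))
    ... | inj₂ (off , re)  | inj₁ (on , alt)  =
      ⊥-elim (off (closed on e<k (sym ee) (subst (Alternate (c f)) (trans (sym same) re) alt)))

    recoloured-proper : Proper k recoloured
    recoloured-proper = recoloured-properAt L (proj₁ proper) closedL
                      , recoloured-properAt R (proj₂ proper) closedR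

    a-free-at-y : Free R k recoloured y a
    a-free-at-y (f , f<k , ry , ra) with recoloured-cases f
    ... | inj₁ (_ , inj₁ (_ , rb)) = a≢b (trans (sym ra) rb)
    ... | inj₁ (_ , inj₂ (cb , _)) = b-free (f , f<k , ry , cb)
    ... | inj₂ (off , rf) = off (zero , AtR.edgeAt-complete (f<k , ry , trans (sym rf) ra))

    a-free-preserved : ∀ {x} → Free L k c x a → Free L k recoloured x a
    a-free-preserved a-free (f , f<k , lx , ra) with recoloured-cases f
    ... | inj₂ (_ , rf) = a-free (f , f<k , lx , trans (sym rf) ra)
    ... | inj₁ (_ , inj₁ (_ , rb)) = a≢b (trans (sym ra) rb)
    ... | inj₁ ((zero , wf) , inj₂ (cb , _)) with AtR.edgeAt-sound wf
    ...   | _ , _ , ca = a≢b (trans (sym ca) cb)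
    a-free-preserved a-free (f , f<k , lx , ra) | inj₁ ((suc i , wf) , inj₂ (cb , _))
      with walk-step i wf
    ...   | _ , we′ , viaL ca′ _ le′ , _ = a-free (_ , proj₁ (walk-valid i we′) , trans le′ lx , ca′)
    ...   | _ , _ , viaR _ ca _ , _ = a≢b (trans (sym ca) cb)

  extend : ∀ {k} → k < m → Σ Colouring (Proper k) → Σ Colouring (Proper (suc k))
  extend {k} k<m (c , proper) =
    choose (free-colour _≟X_ L slotL slotL-injective k c e₀ k≤e₀)
           (free-colour _≟Y_ R slotR slotR-injective k c e₀ k≤e₀)
    where
    e₀ : Fin m
    e₀ = Fin.fromℕ< k<m

    e₀≡k : toℕ e₀ ≡ k
    e₀≡k = Fin.toℕ-fromℕ< k<m

    k≤e₀ : k ≤ toℕ e₀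
    k≤e₀ = ℕ.≤-reflexive (sym e₀≡k)

    paint : ∀ c′ α → Proper k c′ → Free L k c′ (L e₀) α → Free R k c′ (R e₀) α →
            Σ Colouring (Proper (suc k))
    paint c′ α (properL , properR) freeL freeR =
      updateAt c′ e₀ (const α) ,
      properAt-extend L e₀ e₀≡k freeL properL , properAt-extend R e₀ e₀≡k freeR properR

    choose : ∃ (Free L k c (L e₀)) → ∃ (Free R k c (R e₀)) → Σ Colouring (Proper (suc k))
    choose (α , α-free) (β , β-free) with α Fin.≟ β
    ... | yes refl = paint c α proper α-free β-free
    ... | no α≢β   = paint recoloured α recoloured-proper (a-free-preserved α-free) a-free-at-y
      where open KempeExchange proper α≢β (R e₀) β-free

  -- The initial colouring is irrelevant; slotL merely avoids assuming Δ > 0.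
  colour-first : ∀ k → k ≤ m → Σ Colouring (Proper k)
  colour-first zero    _   = slotL , (λ _ _ ()) , (λ _ _ ())
  colour-first (suc k) k<m = extend k<m (colour-first k (ℕ.<⇒≤ k<m))

  proper-edge-colouring : Σ Colouring λ c →
    (∀ e f → L e ≡ L f → c e ≡ c f → e ≡ f) × (∀ e f → R e ≡ R f → c e ≡ c f → e ≡ f)
  proper-edge-colouring with colour-first m ℕ.≤-refl
  ... | c , properL , properR =
    c , (λ e f → properL e f (Fin.toℕ<n e) (Fin.toℕ<n f))
      , (λ e f → properR e f (Fin.toℕ<n e) (Fin.toℕ<n f))

module ArcColouringByPorts (G : Graph) where

  neighbours : Fin (n G) → List (Fin (n G))
  neighbours u = filterᵇ (adj G u) (allFin (n G))

  ∈-neighbours : ∀ {u v} → T (adj G u v) → v ∈ neighbours u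
  ∈-neighbours {u} {v} = ∈-filter⁺ (T? ∘ adj G u) (∈-allFin v)

  neighbourRank : ∀ {u v} → T (adj G u v) → Fin (deg G u)
  neighbourRank = Any.index ∘ ∈-neighbours

  neighbourRank-injective : ∀ {u v w} (uv : T (adj G u v)) (uw : T (adj G u w)) →
    neighbourRank uv ≡ neighbourRank uw → v ≡ w
  neighbourRank-injective {u} uv uw eq =
    trans (lookup-index (∈-neighbours uv))
          (trans (cong (lookup (neighbours u)) eq) (sym (lookup-index (∈-neighbours uw))))

  Group : Fin (n G) → Set
  Group u = Fin ⌈ deg G u /3⌉

  groupSlot : ∀ {u v} → T (adj G u v) → Group u × Fin 3
  groupSlot {u} uv = remQuot 3 (inject≤ (neighbourRank uv) (d≤⌈d/3⌉*3 (deg G u)))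

  groupSlot-injective : ∀ {u v w} (uv : T (adj G u v)) (uw : T (adj G u w)) →
    groupSlot uv ≡ groupSlot uw → v ≡ w
  groupSlot-injective uv uw eq =
    neighbourRank-injective uv uw (Fin.inject≤-injective _ _ _ _ (remQuot-injective 3 eq))

  Port : Set
  Port = (Fin (n G) × ℕ) ⊎ (Fin (n G) × Fin (n G))

  _≟Port_ : DecidableEquality Port
  _≟Port_ = Sum.≡-dec (Product.≡-dec Fin._≟_ ℕ._≟_) (Product.≡-dec Fin._≟_ Fin._≟_)

  -- Every ordered pair (u, v) is an edge of the bipartite multigraph, with left end port (u , v)
  -- and right end port (v , u). For an arc the port at u is u with the group of v among the
  -- neighbours of u; a non-adjacent pair gets ends of its own, so it constrains nothing.
  portAt : ∀ u v → Dec (T (adj G u v)) → Port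
  portAt u v (yes uv) = inj₁ (u , toℕ (proj₁ (groupSlot uv)))
  portAt u v (no _)   = inj₂ (u , v)

  slotAt : ∀ u v → Dec (T (adj G u v)) → Fin 3
  slotAt u v (yes uv) = proj₂ (groupSlot uv)
  slotAt u v (no _)   = Fin.zero

  port : Fin (n G) × Fin (n G) → Port
  port (u , v) = portAt u v (T? (adj G u v))

  slot : Fin (n G) × Fin (n G) → Fin 3
  slot (u , v) = slotAt u v (T? (adj G u v))

  port-arc : ∀ {u v} (uv : T (adj G u v)) → port (u , v) ≡ inj₁ (u , toℕ (proj₁ (groupSlot uv)))
  port-arc {u} {v} uv = cong (portAt u v) (dec-yes-irr (T? (adj G u v)) T-irrelevant uv)

  port-injective : ∀ p q → port p ≡ port q → slot p ≡ slot q → p ≡ q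
  port-injective (u , v) (u′ , v′) = portAt-injective (T? _) (T? _)
    where
    portAt-injective : ∀ d d′ → portAt u v d ≡ portAt u′ v′ d′ → slotAt u v d ≡ slotAt u′ v′ d′ →
                       (u , v) ≡ (u′ , v′)
    portAt-injective (yes uv) (yes uv′) eq same-slot
      with refl ← cong proj₁ (Sum.inj₁-injective eq) =
      cong (u ,_) (groupSlot-injective uv uv′ (Product.×-≡,≡→≡ (same-group , same-slot)))
      where same-group = Fin.toℕ-injective (cong proj₂ (Sum.inj₁-injective eq))
    portAt-injective (no _) (no _) eq _ = Sum.inj₂-injective eq

  pair : Fin (n G * n G) → Fin (n G) × Fin (n G)
  pair = remQuot (n G)

  open BipartiteEdgeColouring _≟Port_ _≟Port_ (port ∘ pair) (port ∘ swap ∘ pair)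
         (slot ∘ pair) (slot ∘ swap ∘ pair)
         (λ e f same-port same-slot →
            remQuot-injective (n G) (port-injective _ _ same-port same-slot))
         (λ e f same-port same-slot →
            remQuot-injective (n G) (cong swap (port-injective _ _ same-port same-slot)))
    using (proper-edge-colouring)

  colouring : ArcColouring G 3
  colouring u v = proj₁ proper-edge-colouring (combine u v)

  out-proper : ∀ {u v w} → port (u , v) ≡ port (u , w) → colouring u v ≡ colouring u w → v ≡ w
  out-proper {u} {v} {w} same-port same-colour =
    Fin.combine-injectiveʳ u v u w (proj₁ (proj₂ proper-edge-colouring) _ _ ports same-colour)
    where
    ports = trans (cong port (Fin.remQuot-combine u v))
                  (trans same-port (sym (cong port (Fin.remQuot-combine u w))))

  in-proper : ∀ {u v w} → port (u , v) ≡ port (u , w) → colouring v u ≡ colouring w u → v ≡ w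
  in-proper {u} {v} {w} same-port same-colour =
    Fin.combine-injectiveˡ v u w u (proj₂ (proj₂ proper-edge-colouring) _ _ ports same-colour)
    where
    ports = trans (cong (port ∘ swap) (Fin.remQuot-combine v u))
                  (trans same-port (sym (cong (port ∘ swap) (Fin.remQuot-combine w u))))

  colour-class-bound : ∀ u (P : Fin (n G) → Bool) (adjacent : ∀ {v} → T (P v) → T (adj G u v)) →
    (∀ {v w} → T (P v) → T (P w) → port (u , v) ≡ port (u , w) → v ≡ w) →
    length (filterᵇ P (allFin (n G))) ≤ ⌈ deg G u /3⌉
  colour-class-bound u P adjacent distinct =
    length-≤-by-injection (Unique.filter⁺ (T? ∘ P) (Unique.allFin⁺ (n G))) group group-injective
    where
    member : ∀ {v} → v ∈ filterᵇ P (allFin (n G)) → T (P v)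
    member = proj₂ ∘ ∈-filter⁻ (T? ∘ P) {xs = allFin (n G)}

    group : ∀ {v} → v ∈ filterᵇ P (allFin (n G)) → Group u
    group = proj₁ ∘ groupSlot ∘ adjacent ∘ member

    group-injective : ∀ {v w} p q → group {v} p ≡ group {w} q → v ≡ w
    group-injective p q same-group = distinct (member p) (member q)
      (trans (port-arc _) (trans (cong (λ g → inj₁ (u , toℕ g)) same-group) (sym (port-arc _))))

  out-bound : ∀ u α → outColourCount G colouring u α ≤ ⌈ deg G u /3⌉
  out-bound u α = colour-class-bound u (λ v → adj G u v ∧ ⌊ colouring u v Fin.≟ α ⌋)
    (proj₁ ∘ Equivalence.to T-∧)
    λ pv pw same-port → out-proper same-port (trans (coloured pv) (sym (coloured pw)))
    where
    coloured : ∀ {v} → T (adj G u v ∧ ⌊ colouring u v Fin.≟ α ⌋) → colouring u v ≡ α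
    coloured {v} = toWitness {a? = colouring u v Fin.≟ α} ∘ proj₂ ∘ Equivalence.to T-∧

  in-bound : ∀ u α → inColourCount G colouring u α ≤ ⌈ deg G u /3⌉
  in-bound u α = colour-class-bound u (λ v → adj G v u ∧ ⌊ colouring v u Fin.≟ α ⌋)
    (subst T (Graph.sym G _ u) ∘ proj₁ ∘ Equivalence.to T-∧)
    λ pv pw same-port → in-proper same-port (trans (coloured pv) (sym (coloured pw)))
    where
    coloured : ∀ {v} → T (adj G v u ∧ ⌊ colouring v u Fin.≟ α ⌋) → colouring v u ≡ α
    coloured {v} = toWitness {a? = colouring v u Fin.≟ α} ∘ proj₂ ∘ Equivalence.to T-∧

  colouring-is-majority : minDegree≥ G 2 → IsMajorityArcColouring G colouring
  colouring-is-majority δ≥2 u α = at-most-half (out-bound u α) , at-most-half (in-bound u α)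
    where
    at-most-half : ∀ {x} → x ≤ ⌈ deg G u /3⌉ → 2 * x ≤ deg G u
    at-most-half x≤ = ℕ.≤-trans (ℕ.*-monoʳ-≤ 2 x≤) (2*⌈d/3⌉≤d (δ≥2 u))

theorem25 : (G : Graph) → minDegree≥ G 2 → M'≤ G 3
theorem25 G δ≥2 = 3 , ℕ.≤-refl , colouring , colouring-is-majority δ≥2
  where open ArcColouringByPorts G
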